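{- For every $n \ge 2$, the number of $321$-avoiding derangements of $\{1,\dots,n\}$ equals the number of nodes at depth $n-2$ (the root having depth $0$) of the rooted labeled tree $\mathcal{T}$ defined by the following succession system: the root has label $[2]$; a node with label $[T]$ has exactly three children, with labels $[T],[2],[3]$; a node with label $[t]$, $t \ge 2$ an integer, has exactly $t$ children, with labels $[T],[3],[4],\dots,[t+1]$.
   Context: A derangement of $\{1,\dots,n\}$ is a permutation $\pi$ with $\pi(i)\neq i$ for all $i$. A permutation $\pi$ of $\{1,\dots,n\}$ avoids the pattern $321$ if there are no indices $i<j<k$ with $\pi(i)>\pi(j)>\pi(k)$. In the tree $\mathcal{T}$, the number and labels of the children of a node are determined solely by its label, as specified by the succession system. -}

module Defs where

open import Data.Nat using (ℕ; zero; suc; _+_; _<_)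
open import Data.Nat using (_<ᵇ_; _≡ᵇ_)
open import Data.Bool using (Bool; true; false; not; _∧_; _∨_) renaming (T to IsTrue)
open import Data.Fin using (Fin; toℕ)
open import Data.Vec using (Vec; lookup)
open import Data.List using (List; []; _∷_; concatMap; length; allFin)
open import Data.Bool.ListAction using (all; any)
open import Data.Product using (Σ)

allF : ∀ {n} → (Fin n → Bool) → Bool
allF {n} p = all p (allFin n)

anyF : ∀ {n} → (Fin n → Bool) → Bool
anyF {n} p = any p (allFin n)

_<ᵇF_ : ∀ {n} → Fin n → Fin n → Bool
i <ᵇF j = toℕ i <ᵇ toℕ j

_=ᵇF_ : ∀ {n} → Fin n → Fin n → Bool
i =ᵇF j = toℕ i ≡ᵇ toℕ j

-- A word in one-line notation: w(i) = lookup w i (0-indexed, values in Fin n).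
-- It is a permutation iff it is injective (n positions into n values).
isPermᵇ : ∀ {n} → Vec (Fin n) n → Bool
isPermᵇ w = allF λ i → allF λ j → not (lookup w i =ᵇF lookup w j) ∨ (i =ᵇF j)

isDerangementᵇ : ∀ {n} → Vec (Fin n) n → Bool
isDerangementᵇ w = allF λ i → not (lookup w i =ᵇF i)

contains321ᵇ : ∀ {n} → Vec (Fin n) n → Bool
contains321ᵇ w = anyF λ i → anyF λ j → anyF λ k →
  (i <ᵇF j) ∧ (j <ᵇF k) ∧ (lookup w j <ᵇF lookup w i) ∧ (lookup w k <ᵇF lookup w j)

avoids321ᵇ : ∀ {n} → Vec (Fin n) n → Bool
avoids321ᵇ w = not (contains321ᵇ w)

-- The set of 321-avoiding derangements of {1,…,n}, as one-line words
-- satisfying the (decidable) conditions; the proof component is of type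
-- `IsTrue b`, which is proof-irrelevant, so this set has the intended cardinality.
AvoidingDerangement : ℕ → Set
AvoidingDerangement n =
  Σ (Vec (Fin n) n) λ w → IsTrue (isPermᵇ w ∧ isDerangementᵇ w ∧ avoids321ᵇ w)

data Label : Set where
  T   : Label
  num : ℕ → Label

range3 : ℕ → ℕ → List Label
range3 zero    s = []
range3 (suc m) s = num s ∷ range3 m (suc s)

children : Label → List Label
children T       = T ∷ num 2 ∷ num 3 ∷ []
-- [t] (t ≥ 2) has children [T],[3],…,[t+1]: that is 1 + (t-1) = t children.
-- Labels num 0 / num 1 never occur in the tree; their rule is irrelevant.
children (num zero)    = []
children (num (suc t)) = T ∷ range3 t 3

root : Label
root = num 2

level : ℕ → List Label
level zero    = root ∷ []
level (suc d) = concatMap children (level d)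

nodesAtDepth : ℕ → ℕ
nodesAtDepth d = length (level d)

module Submission where

-- A 321-avoiding permutation f maps its excedances (i < f i) increasingly onto the excedance
-- values and its other positions increasingly onto the other values, so it is determined by
-- recording at each i whether i is an excedance and whether i is an excedance value. Read as
-- steps U, D, L₁, L₂, these pairs form a Motzkin path with two kinds of level steps whose height
-- at i counts the arcs j ↦ f j passing over i; for a derangement no level step occurs at height 0,
-- and every such path decodes back to a 321-avoiding derangement.
--
-- On the tree side, label [t] carries the multiset of sizes of the subsets of a t-set and [T] the
-- multiset {0,1,1,1,2}. One path step from every height of a node gives exactly the heights of its
-- children, so summing over depth d the number of paths of length k from the heights of the nodes
-- is invariant under d ↦ d + 1, k ↦ k - 1. Since the root [2] carries {0,1,1,2}, the nodes at
-- depth m are as many as the paths of length m + 2 from height 0.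

open import Defs
open import Data.Bool using (Bool; true; false; not; _∧_; _∨_; if_then_else_) renaming (T to IsTrue)
open import Data.Bool.Properties using (T-∧; T-irrelevant; not-injective)
open import Data.Empty using (⊥; ⊥-elim)
open import Data.Fin using (Fin; toℕ; fromℕ<)
open import Data.Fin.Properties
  using (toℕ<n; toℕ-fromℕ<; toℕ-injective; injective⇒≤; punchOut-injective; any?; +↔⊎; 0↔⊥)
open import Data.List using (List; []; _∷_; _++_; map; concatMap; length; allFin)
open import Data.List.Membership.Propositional.Properties using (∈-allFin)
open import Data.List.Properties using (map-++; map-∘; map-cong)
open import Data.List.Relation.Unary.All as All using (All; []; _∷_)
import Data.List.Relation.Unary.All.Properties as Allₚ
open import Data.List.Relation.Unary.Any using (satisfied)
import Data.List.Relation.Unary.Any.Properties as Anyₚ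
open import Data.Nat using (ℕ; zero; suc; _+_; _*_; _∸_; _≤_; _<_; z≤n; s≤s; _≡ᵇ_; _<?_; _≤?_; _≟_)
open import Data.Nat.Induction using (<-rec)
open import Data.Nat.ListAction using (sum)
open import Data.Nat.ListAction.Properties using (sum-++)
open import Data.Nat.Properties
open import Data.Nat.Tactic.RingSolver using (solve-∀)
open import Data.Product using (Σ; ∃; ∃-syntax; _×_; _,_; proj₁; proj₂)
open import Data.Sum using (_⊎_; inj₁; inj₂)
open import Data.Sum.Function.Propositional using (_⊎-↔_)
open import Data.Vec as Vec using (Vec; []; _∷_; lookup; tabulate)
open import Data.Vec.Properties using (lookup-map; lookup∘tabulate; tabulate∘lookup; tabulate-cong)
open import Function using (_∘_)
open import Function.Bundles using (_↔_; _⇔_; mk↔ₛ′; mk⇔; Equivalence)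
open import Function.Properties.Inverse using (↔-trans; ↔-sym)
open import Relation.Binary.Definitions using (tri<; tri≈; tri>)
open import Relation.Binary.PropositionalEquality
open import Relation.Nullary using (Dec; yes; no; does; ¬_)
open import Relation.Nullary.Decidable using (dec-true; dec-false; does-⇔; _×-dec_)
open import Relation.Unary using (Decidable)

private
  variable
    A B : Set

weight : (A → ℕ) → List A → ℕ
weight φ xs = sum (map φ xs)

weight-++ : ∀ (φ : A → ℕ) xs ys → weight φ (xs ++ ys) ≡ weight φ xs + weight φ ys
weight-++ φ xs ys = trans (cong sum (map-++ φ xs ys)) (sum-++ (map φ xs) (map φ ys))

weight-+ : ∀ (φ ψ : A → ℕ) xs → weight (λ x → φ x + ψ x) xs ≡ weight φ xs + weight ψ xs
weight-+ φ ψ []       = refl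
weight-+ φ ψ (x ∷ xs) = trans (cong (φ x + ψ x +_) (weight-+ φ ψ xs)) (shuffle (φ x) (ψ x) _ _)
  where
  shuffle : ∀ a b c d → a + b + (c + d) ≡ a + c + (b + d)
  shuffle = solve-∀

weight-cong-≗ : ∀ {φ ψ : A → ℕ} → (∀ x → φ x ≡ ψ x) → ∀ xs →
                weight φ xs ≡ weight ψ xs
weight-cong-≗ φ≗ψ xs = cong sum (map-cong φ≗ψ xs)

weight-cong : ∀ {P : A → Set} {φ ψ : A → ℕ} {xs} →
              (∀ {x} → P x → φ x ≡ ψ x) → All P xs → weight φ xs ≡ weight ψ xs
weight-cong φ≗ψ []         = refl
weight-cong φ≗ψ (px ∷ pxs) = cong₂ _+_ (φ≗ψ px) (weight-cong φ≗ψ pxs)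

weight-const-1 : ∀ (xs : List A) → weight (λ _ → 1) xs ≡ length xs
weight-const-1 []       = refl
weight-const-1 (x ∷ xs) = cong suc (weight-const-1 xs)

weight-map : ∀ (φ : B → ℕ) (f : A → B) xs → weight φ (map f xs) ≡ weight (φ ∘ f) xs
weight-map φ f xs = cong sum (sym (map-∘ xs))

weight-concatMap : ∀ (φ : B → ℕ) (f : A → List B) xs →
                   weight φ (concatMap f xs) ≡ weight (weight φ ∘ f) xs
weight-concatMap φ f []       = refl
weight-concatMap φ f (x ∷ xs) =
  trans (weight-++ φ (f x) (concatMap f xs)) (cong (weight φ (f x) +_) (weight-concatMap φ f xs))

-- Motzkin paths with bicoloured level steps

-- One entry per legal step from height h, in the order D, L₁, L₂, U.
next : ℕ → List ℕ
next zero    = 1 ∷ []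
next (suc h) = h ∷ suc h ∷ suc h ∷ suc (suc h) ∷ []

pathCount : ℕ → ℕ → ℕ
pathCount zero    zero    = 1
pathCount zero    (suc h) = 0
pathCount (suc n) h       = weight (pathCount n) (next h)

data Step : Set where
  U D L₁ L₂ : Step

isPathᵇ : ∀ {n} → ℕ → Vec Step n → Bool
isPathᵇ h       []       = h ≡ᵇ 0
isPathᵇ h       (U ∷ v)  = isPathᵇ (suc h) v
isPathᵇ zero    (D ∷ v)  = false
isPathᵇ zero    (L₁ ∷ v) = false
isPathᵇ zero    (L₂ ∷ v) = false
isPathᵇ (suc h) (D ∷ v)  = isPathᵇ h v
isPathᵇ (suc h) (L₁ ∷ v) = isPathᵇ (suc h) v
isPathᵇ (suc h) (L₂ ∷ v) = isPathᵇ (suc h) v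

Path : ℕ → ℕ → Set
Path n h = Σ (Vec Step n) λ v → IsTrue (isPathᵇ h v)

⨄ : (A → Set) → List A → Set
⨄ F []       = ⊥
⨄ F (x ∷ xs) = F x ⊎ ⨄ F xs

⨄↔Fin-weight : ∀ {F : A → Set} {c : A → ℕ} →
               (∀ x → F x ↔ Fin (c x)) → ∀ xs → ⨄ F xs ↔ Fin (weight c xs)
⨄↔Fin-weight F↔c []       = ↔-sym 0↔⊥
⨄↔Fin-weight F↔c (x ∷ xs) = ↔-trans (F↔c x ⊎-↔ ⨄↔Fin-weight F↔c xs) (↔-sym +↔⊎)

Path-suc : ∀ n h → Path (suc n) h ↔ ⨄ (Path n) (next h)
Path-suc n zero = mk↔ₛ′ to from (λ { (inj₁ _) → refl }) (λ { (U ∷ _ , _) → refl })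
  where
  to : Path (suc n) 0 → ⨄ (Path n) (next 0)
  to (U ∷ v , p) = inj₁ (v , p)
  from : ⨄ (Path n) (next 0) → Path (suc n) 0
  from (inj₁ (v , p)) = U ∷ v , p
Path-suc n (suc h) = mk↔ₛ′ to from to∘from from∘to
  where
  to : Path (suc n) (suc h) → ⨄ (Path n) (next (suc h))
  to (D  ∷ v , p) = inj₁ (v , p)
  to (L₁ ∷ v , p) = inj₂ (inj₁ (v , p))
  to (L₂ ∷ v , p) = inj₂ (inj₂ (inj₁ (v , p)))
  to (U  ∷ v , p) = inj₂ (inj₂ (inj₂ (inj₁ (v , p))))
  from : ⨄ (Path n) (next (suc h)) → Path (suc n) (suc h)
  from (inj₁ (v , p))                      = D  ∷ v , p
  from (inj₂ (inj₁ (v , p)))               = L₁ ∷ v , p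
  from (inj₂ (inj₂ (inj₁ (v , p))))        = L₂ ∷ v , p
  from (inj₂ (inj₂ (inj₂ (inj₁ (v , p))))) = U  ∷ v , p
  to∘from : ∀ x → to (from x) ≡ x
  to∘from (inj₁ _)                      = refl
  to∘from (inj₂ (inj₁ _))               = refl
  to∘from (inj₂ (inj₂ (inj₁ _)))        = refl
  to∘from (inj₂ (inj₂ (inj₂ (inj₁ _)))) = refl
  from∘to : ∀ x → from (to x) ≡ x
  from∘to (D  ∷ _ , _) = refl
  from∘to (L₁ ∷ _ , _) = refl
  from∘to (L₂ ∷ _ , _) = refl
  from∘to (U  ∷ _ , _) = refl

Path↔Fin : ∀ n h → Path n h ↔ Fin (pathCount n h)
Path↔Fin zero    zero    =
  mk↔ₛ′ (λ _ → Fin.zero) (λ _ → [] , _) (λ { Fin.zero → refl ; (Fin.suc ()) }) (λ { ([] , _) → refl })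
Path↔Fin zero    (suc h) =
  ↔-trans (mk↔ₛ′ (λ { ([] , ()) }) (λ ()) (λ ()) (λ { ([] , ()) })) (↔-sym 0↔⊥)
Path↔Fin (suc n) h       = ↔-trans (Path-suc n h) (⨄↔Fin-weight (Path↔Fin n) (next h))

data LegalStep : ℕ → Step → ℕ → Set where
  up    : ∀ {h} → LegalStep h U (suc h)
  down  : ∀ {h} → LegalStep (suc h) D h
  flat₁ : ∀ {h} → LegalStep (suc h) L₁ (suc h)
  flat₂ : ∀ {h} → LegalStep (suc h) L₂ (suc h)

isPath-∷⁺ : ∀ {n h h′ s} {v : Vec Step n} →
            LegalStep h s h′ → IsTrue (isPathᵇ h′ v) → IsTrue (isPathᵇ h (s ∷ v))
isPath-∷⁺ up    p = p
isPath-∷⁺ down  p = p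
isPath-∷⁺ flat₁ p = p
isPath-∷⁺ flat₂ p = p

isPath-∷⁻ : ∀ {n} h s (v : Vec Step n) →
            IsTrue (isPathᵇ h (s ∷ v)) → ∃[ h′ ] LegalStep h s h′ × IsTrue (isPathᵇ h′ v)
isPath-∷⁻ h       U  v p = suc h , up , p
isPath-∷⁻ (suc h) D  v p = h , down , p
isPath-∷⁻ (suc h) L₁ v p = suc h , flat₁ , p
isPath-∷⁻ (suc h) L₂ v p = suc h , flat₂ , p

-- Label heights in the generating tree

popcounts : ℕ → List ℕ
popcounts zero    = 0 ∷ []
popcounts (suc t) = popcounts t ++ map suc (popcounts t)

heights : Label → List ℕ
heights T       = 0 ∷ 1 ∷ 1 ∷ 1 ∷ 2 ∷ []
heights (num t) = popcounts t

data NonLeaf : Label → Set where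
  T-nonLeaf   : NonLeaf T
  num-nonLeaf : ∀ t → NonLeaf (num (suc t))

weight-popcounts-suc : ∀ (φ : ℕ → ℕ) t →
                       weight φ (popcounts (suc t)) ≡ weight (λ x → φ x + φ (suc x)) (popcounts t)
weight-popcounts-suc φ t = begin
  weight φ (P ++ map suc P)                 ≡⟨ weight-++ φ P _ ⟩
  weight φ P + weight φ (map suc P)         ≡⟨ cong (weight φ P +_) (weight-map φ suc P) ⟩
  weight φ P + weight (φ ∘ suc) P           ≡⟨ weight-+ φ (φ ∘ suc) P ⟨
  weight (λ x → φ x + φ (suc x)) P          ∎
  where
  open ≡-Reasoning
  P = popcounts t

weight-next-popcounts-suc : ∀ (φ : ℕ → ℕ) u →
  weight (weight φ ∘ next) (popcounts (suc u)) ≡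
  weight (weight φ ∘ next) (popcounts u) + weight φ (popcounts (suc (suc u)))
weight-next-popcounts-suc φ u = begin
  weight N (popcounts (suc u))                        ≡⟨ weight-popcounts-suc N u ⟩
  weight (λ x → N x + N (suc x)) P                    ≡⟨ weight-+ N (N ∘ suc) P ⟩
  weight N P + weight (N ∘ suc) P                     ≡⟨ cong (weight N P +_) twoSteps ⟩
  weight N P + weight φ (popcounts (suc (suc u)))     ∎
  where
  open ≡-Reasoning
  N = weight φ ∘ next
  P = popcounts u
  regroup : ∀ a b c → a + (b + (b + (c + 0))) ≡ a + b + (b + c)
  regroup = solve-∀
  twoSteps : weight (N ∘ suc) P ≡ weight φ (popcounts (suc (suc u)))
  twoSteps = begin
    weight (N ∘ suc) P
      ≡⟨ weight-cong-≗ (λ x → regroup (φ x) (φ (suc x)) (φ (suc (suc x)))) P ⟩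
    weight (λ x → φ x + φ (suc x) + (φ (suc x) + φ (suc (suc x)))) P
      ≡⟨ weight-popcounts-suc (λ x → φ x + φ (suc x)) u ⟨
    weight (λ x → φ x + φ (suc x)) (popcounts (suc u))
      ≡⟨ weight-popcounts-suc φ (suc u) ⟨
    weight φ (popcounts (suc (suc u)))
      ∎

weight-range3-suc : ∀ (Ψ : Label → ℕ) t s →
                    weight Ψ (range3 (suc t) s) ≡ weight Ψ (range3 t s) + Ψ (num (t + s))
weight-range3-suc Ψ zero    s = +-identityʳ (Ψ (num s))
weight-range3-suc Ψ (suc t) s = begin
  Ψ (num s) + weight Ψ (range3 (suc t) (suc s))
    ≡⟨ cong (Ψ (num s) +_) (weight-range3-suc Ψ t (suc s)) ⟩
  Ψ (num s) + (weight Ψ R + Ψ (num (t + suc s)))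
    ≡⟨ +-assoc (Ψ (num s)) _ _ ⟨
  Ψ (num s) + weight Ψ R + Ψ (num (t + suc s))
    ≡⟨ cong (λ k → Ψ (num s) + weight Ψ R + Ψ (num k)) (+-suc t s) ⟩
  Ψ (num s) + weight Ψ R + Ψ (num (suc t + s))
    ∎
  where
  open ≡-Reasoning
  R = range3 t (suc s)

weight-next-popcounts : ∀ (φ : ℕ → ℕ) t →
  weight (weight φ ∘ next) (popcounts (suc t)) ≡ weight (weight φ ∘ heights) (children (num (suc t)))
weight-next-popcounts φ zero = regroup (φ 0) (φ 1) (φ 2)
  where
  regroup : ∀ a b c → b + 0 + (a + (b + (b + (c + 0))) + 0) ≡ a + (b + (b + (b + (c + 0)))) + 0
  regroup = solve-∀
weight-next-popcounts φ (suc t) = begin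
  weight N (popcounts (suc (suc t)))
    ≡⟨ weight-next-popcounts-suc φ (suc t) ⟩
  weight N (popcounts (suc t)) + Ψ (num (3 + t))
    ≡⟨ cong (_+ Ψ (num (3 + t))) (weight-next-popcounts φ t) ⟩
  Ψ T + weight Ψ R + Ψ (num (3 + t))
    ≡⟨ +-assoc (Ψ T) _ _ ⟩
  Ψ T + (weight Ψ R + Ψ (num (3 + t)))
    ≡⟨ cong (λ k → Ψ T + (weight Ψ R + Ψ (num k))) (+-comm 3 t) ⟩
  Ψ T + (weight Ψ R + Ψ (num (t + 3)))
    ≡⟨ cong (Ψ T +_) (weight-range3-suc Ψ t 3) ⟨
  Ψ T + weight Ψ (range3 (suc t) 3)
    ∎
  where
  open ≡-Reasoning
  N = weight φ ∘ next
  Ψ = weight φ ∘ heights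
  R = range3 t 3

weight-next-heights : ∀ (φ : ℕ → ℕ) {L} → NonLeaf L →
                      weight (weight φ ∘ next) (heights L) ≡ weight (weight φ ∘ heights) (children L)
weight-next-heights φ T-nonLeaf       =
  trans (stepped (φ 0) (φ 1) (φ 2) (φ 3)) (sym (children-T (φ 0) (φ 1) (φ 2) (φ 3)))
  where
  stepped : ∀ a b c d →
    b + 0 + (a + (b + (b + (c + 0))) + (a + (b + (b + (c + 0))) +
      (a + (b + (b + (c + 0))) + (b + (c + (c + (d + 0))) + 0))))
    ≡ 3 * a + 8 * b + 5 * c + d
  stepped = solve-∀
  children-T : ∀ a b c d →
    a + (b + (b + (b + (c + 0)))) + (a + (b + (b + (c + 0))) +
      (a + (b + (b + (c + (b + (c + (c + (d + 0))))))) + 0))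
    ≡ 3 * a + 8 * b + 5 * c + d
  children-T = solve-∀
weight-next-heights φ (num-nonLeaf t) = weight-next-popcounts φ t

nonLeaf-children : ∀ {L} → NonLeaf L → All NonLeaf (children L)
nonLeaf-children T-nonLeaf       = T-nonLeaf ∷ num-nonLeaf 1 ∷ num-nonLeaf 2 ∷ []
nonLeaf-children (num-nonLeaf t) = T-nonLeaf ∷ range3-nonLeaf t 2
  where
  range3-nonLeaf : ∀ t s → All NonLeaf (range3 t (suc s))
  range3-nonLeaf zero    s = []
  range3-nonLeaf (suc t) s = num-nonLeaf s ∷ range3-nonLeaf t (suc s)

level-nonLeaf : ∀ d → All NonLeaf (level d)
level-nonLeaf zero    = num-nonLeaf 1 ∷ []
level-nonLeaf (suc d) = Allₚ.concat⁺ (Allₚ.map⁺ (All.map nonLeaf-children (level-nonLeaf d)))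

pathWeight : ℕ → Label → ℕ
pathWeight k L = weight (pathCount k) (heights L)

pathWeight-suc : ∀ k {L} → NonLeaf L → pathWeight (suc k) L ≡ weight (pathWeight k) (children L)
pathWeight-suc k = weight-next-heights (pathCount k)

pathWeight-zero : ∀ L → pathWeight 0 L ≡ 1
pathWeight-zero T       = refl
pathWeight-zero (num t) = popcounts-one-zero t
  where
  popcounts-one-zero : ∀ t → weight (pathCount 0) (popcounts t) ≡ 1
  popcounts-one-zero zero    = refl
  popcounts-one-zero (suc t) = begin
    weight (pathCount 0) (popcounts (suc t))         ≡⟨ weight-popcounts-suc (pathCount 0) t ⟩
    weight (λ x → pathCount 0 x + 0) (popcounts t)   ≡⟨ weight-cong-≗ (+-identityʳ ∘ pathCount 0) (popcounts t) ⟩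
    weight (pathCount 0) (popcounts t)               ≡⟨ popcounts-one-zero t ⟩
    1                                                ∎
    where open ≡-Reasoning

weight-level : ∀ d k → weight (pathWeight k) (level d) ≡ pathWeight (d + k) root
weight-level zero    k = +-identityʳ (pathWeight k root)
weight-level (suc d) k = begin
  weight (pathWeight k) (concatMap children (level d))
    ≡⟨ weight-concatMap (pathWeight k) children (level d) ⟩
  weight (weight (pathWeight k) ∘ children) (level d)
    ≡⟨ weight-cong (sym ∘ pathWeight-suc k) (level-nonLeaf d) ⟩
  weight (pathWeight (suc k)) (level d)
    ≡⟨ weight-level d (suc k) ⟩
  pathWeight (d + suc k) root
    ≡⟨ cong (λ j → pathWeight j root) (+-suc d k) ⟩
  pathWeight (suc d + k) root
    ∎
  where open ≡-Reasoning

nodesAtDepth≡pathCount : ∀ m → nodesAtDepth m ≡ pathCount (2 + m) 0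
nodesAtDepth≡pathCount m = begin
  length (level m)                       ≡⟨ weight-const-1 (level m) ⟨
  weight (λ _ → 1) (level m)             ≡⟨ weight-cong-≗ (sym ∘ pathWeight-zero) (level m) ⟩
  weight (pathWeight 0) (level m)        ≡⟨ weight-level m 0 ⟩
  pathWeight (m + 0) root                ≡⟨ cong (λ j → pathWeight j root) (+-identityʳ m) ⟩
  pathWeight m root                      ≡⟨ +-identityʳ (pathWeight m root) ⟨
  pathCount (2 + m) 0                    ∎
  where open ≡-Reasoning

boolToℕ : Bool → ℕ
boolToℕ true  = 1
boolToℕ false = 0

count : (ℕ → Bool) → ℕ → ℕ
count p zero    = 0
count p (suc m) = boolToℕ (p 0) + count (p ∘ suc) m

count-snoc : ∀ p m → count p (suc m) ≡ count p m + boolToℕ (p m)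
count-snoc p zero    = +-identityʳ _
count-snoc p (suc m) =
  trans (cong (boolToℕ (p 0) +_) (count-snoc (p ∘ suc) m)) (sym (+-assoc (boolToℕ (p 0)) _ _))

count-mono : ∀ p {m m′} → m ≤ m′ → count p m ≤ count p m′
count-mono p {m′ = zero}   z≤n = ≤-refl
count-mono p {m} {suc m′} m≤1+m′ with m≤n⇒m<n∨m≡n m≤1+m′
... | inj₂ refl = ≤-refl
... | inj₁ m<1+m′ = begin
  count p m                          ≤⟨ count-mono p (≤-pred m<1+m′) ⟩
  count p m′                         ≤⟨ m≤m+n _ _ ⟩
  count p m′ + boolToℕ (p m′)        ≡⟨ count-snoc p m′ ⟨
  count p (suc m′)                   ∎
  where open ≤-Reasoning

count-suc-true : ∀ p {i} → p i ≡ true → count p (suc i) ≡ suc (count p i)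
count-suc-true p {i} pi = begin
  count p (suc i)              ≡⟨ count-snoc p i ⟩
  count p i + boolToℕ (p i)    ≡⟨ cong (λ b → count p i + boolToℕ b) pi ⟩
  count p i + 1                ≡⟨ +-comm _ 1 ⟩
  suc (count p i)              ∎
  where open ≡-Reasoning

count-suc-false : ∀ p {i} → p i ≡ false → count p (suc i) ≡ count p i
count-suc-false p {i} pi =
  trans (count-snoc p i) (trans (cong (λ b → count p i + boolToℕ b) pi) (+-identityʳ _))

count-strict : ∀ p {i j} → p i ≡ true → i < j → count p i < count p j
count-strict p {i} pi i<j = ≤-trans (≤-reflexive (sym (count-suc-true p pi))) (count-mono p i<j)

count-reflects-< : ∀ p {x y} → count p x < count p y → x < y
count-reflects-< p cx<cy = ≰⇒> (λ y≤x → <⇒≱ cx<cy (count-mono p y≤x))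

count-injective : ∀ p {x y} → p x ≡ true → p y ≡ true → count p x ≡ count p y → x ≡ y
count-injective p {x} {y} px py cx≡cy with <-cmp x y
... | tri< x<y _ _ = ⊥-elim (<-irrefl cx≡cy (count-strict p px x<y))
... | tri≈ _ x≡y _ = x≡y
... | tri> _ _ y<x = ⊥-elim (<-irrefl (sym cx≡cy) (count-strict p py y<x))

count-none : ∀ p m → (∀ {x} → x < m → p x ≡ false) → count p m ≡ 0
count-none p zero    none = refl
count-none p (suc m) none rewrite none (s≤s z≤n) = count-none (p ∘ suc) m (none ∘ s≤s)

count-not : ∀ p m → count (not ∘ p) m + count p m ≡ m
count-not p zero    = refl
count-not p (suc m) with p 0
... | true  = trans (+-suc _ _) (cong suc (count-not (p ∘ suc) m))
... | false = cong suc (count-not (p ∘ suc) m)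

count-+ : ∀ p q r m → (∀ {x} → x < m → boolToℕ (p x) ≡ boolToℕ (q x) + boolToℕ (r x)) →
          count p m ≡ count q m + count r m
count-+ p q r zero    split = refl
count-+ p q r (suc m) split = begin
  boolToℕ (p 0) + count (p ∘ suc) m
    ≡⟨ cong₂ _+_ (split (s≤s z≤n)) (count-+ (p ∘ suc) (q ∘ suc) (r ∘ suc) m (split ∘ s≤s)) ⟩
  boolToℕ (q 0) + boolToℕ (r 0) + (count (q ∘ suc) m + count (r ∘ suc) m)
    ≡⟨ shuffle (boolToℕ (q 0)) (boolToℕ (r 0)) _ _ ⟩
  boolToℕ (q 0) + count (q ∘ suc) m + (boolToℕ (r 0) + count (r ∘ suc) m)
    ∎
  where
  open ≡-Reasoning
  shuffle : ∀ a b c d → a + b + (c + d) ≡ a + c + (b + d)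
  shuffle = solve-∀

count-atMostOne : ∀ {P : ℕ → Set} (P? : Decidable P) m →
                  (∀ {x y} → x < m → y < m → P x → P y → x ≡ y) →
                  count (does ∘ P?) m ≡ boolToℕ (does (anyUpTo? P? m))
count-atMostOne P? zero    unique = refl
count-atMostOne P? (suc m) unique
  rewrite count-snoc (does ∘ P?) m
  with P? m | anyUpTo? P? m | count-atMostOne P? m (λ x<m y<m → unique (m<n⇒m<1+n x<m) (m<n⇒m<1+n y<m))
... | yes Pm | _     | _  = cong (_+ 1) (count-none (does ∘ P?) m λ x<m →
                               dec-false (P? _) λ Px → <-irrefl (unique (m<n⇒m<1+n x<m) ≤-refl Px Pm) x<m)
... | no ¬Pm | yes _ | ih = trans (+-identityʳ _) ih
... | no ¬Pm | no _  | ih = trans (+-identityʳ _) ih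

nth : (ℕ → Bool) → ℕ → ℕ → ℕ
nth p k       zero    = 0
nth p zero    (suc m) = if p 0 then 0 else suc (nth (p ∘ suc) zero m)
nth p (suc k) (suc m) = suc (nth (p ∘ suc) (if p 0 then k else suc k) m)

nth-spec : ∀ p k m → k < count p m →
           nth p k m < m × p (nth p k m) ≡ true × count p (nth p k m) ≡ k
nth-spec p zero (suc m) k<count with p 0 in p0
... | true  = s≤s z≤n , p0 , refl
... | false with nth-spec (p ∘ suc) zero m k<count
...   | s<m , ps , cs =
  s≤s s<m , ps , trans (cong (λ b → boolToℕ b + count (p ∘ suc) (nth (p ∘ suc) 0 m)) p0) cs
nth-spec p (suc k) (suc m) k<count with p 0 in p0
... | true  with nth-spec (p ∘ suc) k m (≤-pred k<count)
...   | s<m , ps , cs = s≤s s<m , ps , cong suc cs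
nth-spec p (suc k) (suc m) k<count | false with nth-spec (p ∘ suc) (suc k) m k<count
...   | s<m , ps , cs = s≤s s<m , ps , cs

<-from-sums : ∀ {x y u v} → x + u ≡ y + v → v < u → x < y
<-from-sums x+u≡y+v v<u = ≰⇒> λ y≤x → <-irrefl (sym x+u≡y+v) (+-mono-≤-< y≤x v<u)

boolCases : ∀ {P : Set} (x : Bool) → (x ≡ true → P) → (x ≡ false → P) → P
boolCases true  t f = t refl
boolCases false t f = f refl

bool-pigeonhole : ∀ (x y z : Bool) → x ≡ y ⊎ y ≡ z ⊎ x ≡ z
bool-pigeonhole true  true  _     = inj₁ refl
bool-pigeonhole false false _     = inj₁ refl
bool-pigeonhole true  false false = inj₂ (inj₁ refl)
bool-pigeonhole false true  true  = inj₂ (inj₁ refl)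
bool-pigeonhole true  false true  = inj₂ (inj₂ refl)
bool-pigeonhole false true  false = inj₂ (inj₂ refl)

does-transport : (a? : Dec A) (b? : Dec B) → does a? ≡ does b? → A → B
does-transport (yes _) (yes b) _  _ = b
does-transport (no ¬a) _       _  a = ⊥-elim (¬a a)
does-transport (yes _) (no _)  () _

≡-withProof : ∀ {P : A → Bool} {x y : A} {p : IsTrue (P x)} {q : IsTrue (P y)} →
              x ≡ y → _≡_ {A = Σ A (IsTrue ∘ P)} (x , p) (y , q)
≡-withProof {p = p} {q} refl = cong (_ ,_) (T-irrelevant p q)

InjectiveBelow : ℕ → (ℕ → ℕ) → Set
InjectiveBelow m g = ∀ {x y} → x < m → y < m → g x ≡ g y → x ≡ y

MapsBelow : ℕ → ℕ → (ℕ → ℕ) → Set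
MapsBelow m k g = ∀ {x} → x < m → g x < k

module _ {m k : ℕ} {g : ℕ → ℕ} (maps : MapsBelow m k g) where

  restrict : Fin m → Fin k
  restrict i = fromℕ< (maps (toℕ<n i))

  toℕ-restrict : ∀ i → toℕ (restrict i) ≡ g (toℕ i)
  toℕ-restrict i = toℕ-fromℕ< (maps (toℕ<n i))

  restrict-injective : InjectiveBelow m g → ∀ {i j} → restrict i ≡ restrict j → i ≡ j
  restrict-injective inj {i} {j} eq = toℕ-injective (inj (toℕ<n i) (toℕ<n j)
    (trans (sym (toℕ-restrict i)) (trans (cong toℕ eq) (toℕ-restrict j))))

  injectiveBelow⇒≤ : InjectiveBelow m g → m ≤ k
  injectiveBelow⇒≤ inj = injective⇒≤ (restrict-injective inj)

injectiveBelow⇒surjective : ∀ {n g} → MapsBelow n n g → InjectiveBelow n g →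
                            ∀ {v} → v < n → ∃[ x ] x < n × g x ≡ v
injectiveBelow⇒surjective {suc n} {g} maps inj {v} v<n
  with any? (λ i → restrict maps i Data.Fin.≟ fromℕ< v<n)
... | yes (i , gi≡v) =
  toℕ i , toℕ<n i , trans (sym (toℕ-restrict maps i)) (trans (cong toℕ gi≡v) (toℕ-fromℕ< v<n))
... | no missed = ⊥-elim (<-irrefl refl (injective⇒≤ λ {i} {j} →
  restrict-injective maps inj ∘ punchOut-injective (miss i) (miss j)))
  where
  miss : ∀ i → fromℕ< v<n ≢ restrict maps i
  miss i eq = missed (i , sym eq)

interval-pigeonhole : ∀ {a n : ℕ} {g : ℕ → ℕ} → a < n →
                      (∀ {x} → a ≤ x → x < n → a < g x × g x < n) →
                      (∀ {x y} → a ≤ x → a ≤ y → x < n → y < n → g x ≡ g y → x ≡ y) → ⊥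
interval-pigeonhole {a} {n} {g} a<n into inj with m≤n⇒∃[o]m+o≡n a<n
... | d , refl = <-irrefl refl (injectiveBelow⇒≤ {m = suc d} {k = d} {g = g′} maps inj′)
  where
  g′ : ℕ → ℕ
  g′ x = g (a + x) ∸ suc a
  inRange : ∀ {x} → x < suc d → a + x < suc a + d
  inRange {x} x<1+d = subst (a + x <_) (+-suc a d) (+-monoʳ-< a x<1+d)
  shift : ∀ {x} → x < suc d → suc a + g′ x ≡ g (a + x)
  shift x<1+d = m+[n∸m]≡n (proj₁ (into (m≤m+n a _) (inRange x<1+d)))
  maps : MapsBelow (suc d) d g′
  maps x<1+d = +-cancelˡ-< (suc a) _ _
    (subst (_< suc a + d) (sym (shift x<1+d)) (proj₂ (into (m≤m+n a _) (inRange x<1+d))))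
  inj′ : InjectiveBelow (suc d) g′
  inj′ x<1+d y<1+d eq = +-cancelˡ-≡ a _ _ (inj (m≤m+n a _) (m≤m+n a _) (inRange x<1+d) (inRange y<1+d)
    (trans (sym (shift x<1+d)) (trans (cong (suc a +_) eq) (shift y<1+d))))

fromFin : ∀ {n x} → x < n → ∃[ i ] toℕ {n} i ≡ x
fromFin x<n = fromℕ< x<n , toℕ-fromℕ< x<n

tabulateℕ : ∀ n → (ℕ → A) → Vec A n
tabulateℕ zero    f = []
tabulateℕ (suc n) f = f 0 ∷ tabulateℕ n (f ∘ suc)

lookupOr : ∀ {n} → A → Vec A n → ℕ → A
lookupOr d []       _       = d
lookupOr d (x ∷ xs) zero    = x
lookupOr d (x ∷ xs) (suc i) = lookupOr d xs i

tabulateℕ-cong : ∀ n {f g : ℕ → A} → (∀ {i} → i < n → f i ≡ g i) →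
                 tabulateℕ n f ≡ tabulateℕ n g
tabulateℕ-cong zero    f≗g = refl
tabulateℕ-cong (suc n) f≗g = cong₂ _∷_ (f≗g (s≤s z≤n)) (tabulateℕ-cong n (f≗g ∘ s≤s))

tabulateℕ-lookupOr : ∀ {n} (d : A) (xs : Vec A n) → tabulateℕ n (lookupOr d xs) ≡ xs
tabulateℕ-lookupOr d []       = refl
tabulateℕ-lookupOr d (x ∷ xs) = cong (x ∷_) (tabulateℕ-lookupOr d xs)

lookupOr-tabulateℕ : ∀ {n i} (d : A) (f : ℕ → A) → i < n → lookupOr d (tabulateℕ n f) i ≡ f i
lookupOr-tabulateℕ {i = zero}  d f (s≤s _)   = refl
lookupOr-tabulateℕ {i = suc i} d f (s≤s i<n) = lookupOr-tabulateℕ d (f ∘ suc) i<n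

lookupOr-toℕ : ∀ {n} (d : A) (xs : Vec A n) i → lookupOr d xs (toℕ i) ≡ lookup xs i
lookupOr-toℕ d (x ∷ xs) Fin.zero    = refl
lookupOr-toℕ d (x ∷ xs) (Fin.suc i) = lookupOr-toℕ d xs i

-- 321-avoiding derangements and their step sequences

record IsAvoidingDerangement (n : ℕ) (f : ℕ → ℕ) : Set where
  field
    bounded        : MapsBelow n n f
    injective      : InjectiveBelow n f
    fixedPointFree : ∀ {x} → x < n → f x ≢ x
    avoids321      : ∀ {i j k} → i < j → j < k → k < n → f j < f i → f k < f j → ⊥

excedance? : ∀ (f : ℕ → ℕ) i → Dec (i < f i)
excedance? f i = i <? f i

excedanceValue? : ∀ (f : ℕ → ℕ) i → Dec (∃[ j ] j < i × f j ≡ i)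
excedanceValue? f i = anyUpTo? (λ j → f j ≟ i) i

-- Position i of f becomes stepOf (i is an excedance) (i is an excedance value): the arc i ↦ f i
-- of an excedance opens at i and closes at f i.
stepOf : Bool → Bool → Step
stepOf true  false = U
stepOf false true  = D
stepOf true  true  = L₁
stepOf false false = L₂

opens : Step → Bool
opens U  = true
opens D  = false
opens L₁ = true
opens L₂ = false

closes : Step → Bool
closes U  = false
closes D  = true
closes L₁ = true
closes L₂ = false

opens-stepOf : ∀ a b → opens (stepOf a b) ≡ a
opens-stepOf true  true  = refl
opens-stepOf true  false = refl
opens-stepOf false true  = refl
opens-stepOf false false = refl

closes-stepOf : ∀ a b → closes (stepOf a b) ≡ b
closes-stepOf true  true  = refl
closes-stepOf true  false = refl
closes-stepOf false true  = refl
closes-stepOf false false = refl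

stepOf-opens-closes : ∀ s → stepOf (opens s) (closes s) ≡ s
stepOf-opens-closes U  = refl
stepOf-opens-closes D  = refl
stepOf-opens-closes L₁ = refl
stepOf-opens-closes L₂ = refl

stepAt : (ℕ → ℕ) → ℕ → Step
stepAt f i = stepOf (does (excedance? f i)) (does (excedanceValue? f i))

stepAt-cong : ∀ {n f g i} → (∀ {j} → j < n → f j ≡ g j) → i < n → stepAt f i ≡ stepAt g i
stepAt-cong {f = f} {g} {i} f≗g i<n = cong₂ stepOf
  (cong (λ y → does (i <? y)) (f≗g i<n))
  (does-⇔ (mk⇔ (λ (j , j<i , fj≡i) → j , j<i , trans (sym (f≗g (<-trans j<i i<n))) fj≡i)
               (λ (j , j<i , gj≡i) → j , j<i , trans (f≗g (<-trans j<i i<n)) gj≡i))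
          (excedanceValue? f i) (excedanceValue? g i))

height : (ℕ → ℕ) → ℕ → ℕ
height f i = count (λ j → does (i ≤? f j)) i

crossing : (ℕ → ℕ) → ℕ → ℕ
crossing f i = count (λ j → does (i <? f j)) i

height-suc : ∀ f i → height f (suc i) ≡ crossing f i + boolToℕ (does (excedance? f i))
height-suc f i = count-snoc (λ j → does (suc i ≤? f j)) i

≤-split : ∀ i v → boolToℕ (does (i ≤? v)) ≡ boolToℕ (does (i <? v)) + boolToℕ (does (v ≟ i))
≤-split i v with <-cmp i v
... | tri< i<v v≢i _
  rewrite dec-true (i ≤? v) (<⇒≤ i<v) | dec-true (i <? v) i<v | dec-false (v ≟ i) (v≢i ∘ sym) = refl
... | tri≈ _ refl _
  rewrite dec-true (i ≤? i) ≤-refl | dec-false (i <? i) (<-irrefl refl) | dec-true (i ≟ i) refl = refl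
... | tri> _ v≢i v<i
  rewrite dec-false (i ≤? v) (<⇒≱ v<i) | dec-false (i <? v) (<⇒≯ v<i) | dec-false (v ≟ i) (v≢i ∘ sym) = refl

legalStep-stepOf : ∀ c (a? : Dec A) (b? : Dec B) → (¬ A → ¬ B → 1 ≤ c) →
                   LegalStep (c + boolToℕ (does b?)) (stepOf (does a?) (does b?)) (c + boolToℕ (does a?))
legalStep-stepOf c (yes _) (no _)  _ rewrite +-identityʳ c | +-comm c 1 = up
legalStep-stepOf c (no _)  (yes _) _ rewrite +-identityʳ c | +-comm c 1 = down
legalStep-stepOf c (yes _) (yes _) _ rewrite +-comm c 1 = flat₁
legalStep-stepOf zero    (no ¬a) (no ¬b) c≥1 with () ← c≥1 ¬a ¬b
legalStep-stepOf (suc c) (no _)  (no _)  _   rewrite +-identityʳ c = flat₂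

module AvoidingDerangementProperties {n f} (ad : IsAvoidingDerangement n f) where

  open IsAvoidingDerangement ad

  excedance⇒laterSmaller : ∀ {q} → q < n → q < f q → ∃[ r ] q < r × r < n × f r ≤ q
  excedance⇒laterSmaller {q} q<n q<fq with anyUpTo? (λ r → q <? r ×-dec f r ≤? q) n
  ... | yes (r , r<n , q<r , fr≤q) = r , q<r , r<n , fr≤q
  ... | no noneSmaller = ⊥-elim (interval-pigeonhole q<n into (λ _ _ → injective))
    where
    into : ∀ {x} → q ≤ x → x < n → q < f x × f x < n
    into q≤x x<n with m≤n⇒m<n∨m≡n q≤x
    ... | inj₂ refl = q<fq , bounded x<n
    ... | inj₁ q<x  = ≰⇒> (λ fx≤q → noneSmaller (_ , x<n , q<x , fx≤q)) , bounded x<n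

  deficiency⇒earlierLarger : ∀ {p} → p < n → f p < p → ∃[ j ] j < p × p ≤ f j
  deficiency⇒earlierLarger {p} p<n fp<p with anyUpTo? (λ j → p ≤? f j) p
  ... | yes found      = found
  ... | no noneLarger = ⊥-elim (<-irrefl refl (injectiveBelow⇒≤ {m = suc p} into
                          (λ x<1+p y<1+p → injective (<-≤-trans x<1+p p<n) (<-≤-trans y<1+p p<n))))
    where
    into : MapsBelow (suc p) p f
    into x<1+p with m≤n⇒m<n∨m≡n (≤-pred x<1+p)
    ... | inj₂ refl = fp<p
    ... | inj₁ x<p  = ≰⇒> λ p≤fx → noneLarger (_ , x<p , p≤fx)

  values-distinct : ∀ {p q} → p < q → q < n → f p ≢ f q
  values-distinct p<q q<n fp≡fq = <-irrefl (injective (<-trans p<q q<n) q<n fp≡fq) p<q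

  excedances-increasing : ∀ {p q} → p < q → q < n → p < f p → q < f q → f p < f q
  excedances-increasing {p} {q} p<q q<n _ q<fq = ≤∧≢⇒< (≮⇒≥ no321) (values-distinct p<q q<n)
    where
    no321 : ¬ f q < f p
    no321 fq<fp with excedance⇒laterSmaller q<n q<fq
    ... | r , q<r , r<n , fr≤q = avoids321 p<q q<r r<n fq<fp (≤-<-trans fr≤q q<fq)

  deficiencies-increasing : ∀ {p q} → p < q → q < n → f p < p → f q < q → f p < f q
  deficiencies-increasing {p} {q} p<q q<n fp<p _ = ≤∧≢⇒< (≮⇒≥ no321) (values-distinct p<q q<n)
    where
    no321 : ¬ f q < f p
    no321 fq<fp with deficiency⇒earlierLarger (<-trans p<q q<n) fp<p
    ... | j , j<p , p≤fj = avoids321 j<p p<q q<n (<-≤-trans fp<p p≤fj) fq<fp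

  surjective : ∀ {v} → v < n → ∃[ x ] x < n × f x ≡ v
  surjective = injectiveBelow⇒surjective bounded injective

  height-split : ∀ {i} → i < n → height f i ≡ crossing f i + boolToℕ (does (excedanceValue? f i))
  height-split {i} i<n = begin
    height f i
      ≡⟨ count-+ _ _ _ i (λ {j} _ → ≤-split i (f j)) ⟩
    crossing f i + count (λ j → does (f j ≟ i)) i
      ≡⟨ cong (crossing f i +_) (count-atMostOne (λ j → f j ≟ i) i unique) ⟩
    crossing f i + boolToℕ (does (excedanceValue? f i))
      ∎
    where
    open ≡-Reasoning
    unique : ∀ {x y} → x < i → y < i → f x ≡ i → f y ≡ i → x ≡ y
    unique x<i y<i fx≡i fy≡i = injective (<-trans x<i i<n) (<-trans y<i i<n) (trans fx≡i (sym fy≡i))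

  crossing-positive : ∀ {i} → i < n → ¬ i < f i → ¬ (∃[ j ] j < i × f j ≡ i) → 1 ≤ crossing f i
  crossing-positive {i} i<n i≮fi notValue
    with deficiency⇒earlierLarger i<n (≤∧≢⇒< (≮⇒≥ i≮fi) (fixedPointFree i<n))
  ... | j , j<i , i≤fj =
    ≤-trans (s≤s z≤n) (count-strict (λ j → does (i <? f j)) (dec-true (i <? f j) i<fj) j<i)
    where
    i<fj : i < f j
    i<fj = ≤∧≢⇒< i≤fj λ i≡fj → notValue (j , j<i , sym i≡fj)

  height-end : height f n ≡ 0
  height-end = count-none _ n λ j<n → dec-false (n ≤? f _) (<⇒≱ (bounded j<n))

  height-step : ∀ {i} → i < n → LegalStep (height f i) (stepAt f i) (height f (suc i))
  height-step {i} i<n =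
    subst₂ (λ h h′ → LegalStep h (stepAt f i) h′) (sym (height-split i<n)) (sym (height-suc f i))
    (legalStep-stepOf (crossing f i) (excedance? f i) (excedanceValue? f i) (crossing-positive i<n))

module SameSteps {n f₁ f₂} (ad₁ : IsAvoidingDerangement n f₁) (ad₂ : IsAvoidingDerangement n f₂)
  (sameExcedances      : ∀ {i} → i < n → does (excedance? f₁ i) ≡ does (excedance? f₂ i))
  (sameExcedanceValues : ∀ {i} → i < n → does (excedanceValue? f₁ i) ≡ does (excedanceValue? f₂ i))
  where

  open IsAvoidingDerangement ad₁ using (bounded; injective; fixedPointFree)
  module P₂ = AvoidingDerangementProperties ad₂
  open IsAvoidingDerangement ad₂ using () renaming (fixedPointFree to fixedPointFree₂)

  module _ {m} (m<n : m < n) (agree : ∀ {p} → p < m → f₁ p ≡ f₂ p) where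

    preimage-after : ∀ {j} → j < n → f₂ j ≡ f₁ m → f₁ m ≢ f₂ m → m < j
    preimage-after {j} j<n f₂j≡f₁m f₁m≢f₂m with <-cmp j m
    ... | tri< j<m _ _ = ⊥-elim (<-irrefl (injective j<n m<n (trans (agree j<m) f₂j≡f₁m)) j<m)
    ... | tri≈ _ refl _ = ⊥-elim (f₁m≢f₂m (sym f₂j≡f₁m))
    ... | tri> _ _ m<j = m<j

    -- The f₂-preimage of f₁ m lies after m, so monotonicity of the excedance (resp. deficiency)
    -- values of f₂ would give f₂ m < f₁ m.
    f₁≮f₂ : f₁ m < f₂ m → ⊥
    f₁≮f₂ f₁m<f₂m with excedance? f₁ m
    ... | yes m<f₁m with does-transport (excedanceValue? f₁ (f₁ m)) (excedanceValue? f₂ (f₁ m))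
                           (sameExcedanceValues (bounded m<n)) (m , m<f₁m , refl)
    ...   | j , j<f₁m , f₂j≡f₁m = <-asym f₁m<f₂m (subst (f₂ m <_) f₂j≡f₁m
              (P₂.excedances-increasing m<j j<n m<f₂m (subst (j <_) (sym f₂j≡f₁m) j<f₁m)))
      where
      j<n = <-trans j<f₁m (bounded m<n)
      m<j = preimage-after j<n f₂j≡f₁m (<⇒≢ f₁m<f₂m)
      m<f₂m = does-transport (excedance? f₁ m) (excedance? f₂ m) (sameExcedances m<n) m<f₁m
    f₁≮f₂ f₁m<f₂m | no m≮f₁m with P₂.surjective (bounded m<n)
    ... | j , j<n , f₂j≡f₁m = <-asym f₁m<f₂m (subst (f₂ m <_) f₂j≡f₁m
          (P₂.deficiencies-increasing m<j j<n f₂m<m (subst (_< j) (sym f₂j≡f₁m) (<-trans f₁m<m m<j))))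
      where
      m<j = preimage-after j<n f₂j≡f₁m (<⇒≢ f₁m<f₂m)
      f₁m<m = ≤∧≢⇒< (≮⇒≥ m≮f₁m) (fixedPointFree m<n)
      m≮f₂m = m≮f₁m ∘ does-transport (excedance? f₂ m) (excedance? f₁ m) (sym (sameExcedances m<n))
      f₂m<m = ≤∧≢⇒< (≮⇒≥ m≮f₂m) (fixedPointFree₂ m<n)

steps-determine : ∀ {n f₁ f₂} → IsAvoidingDerangement n f₁ → IsAvoidingDerangement n f₂ →
                  (∀ {i} → i < n → stepAt f₁ i ≡ stepAt f₂ i) → ∀ {p} → p < n → f₁ p ≡ f₂ p
steps-determine {n} {f₁} {f₂} ad₁ ad₂ sameStep {p} = <-rec (λ p → p < n → f₁ p ≡ f₂ p) agreeAt p
  where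
  sameExcedances : ∀ {i} → i < n → does (excedance? f₁ i) ≡ does (excedance? f₂ i)
  sameExcedances i<n =
    trans (sym (opens-stepOf _ _)) (trans (cong opens (sameStep i<n)) (opens-stepOf _ _))
  sameExcedanceValues : ∀ {i} → i < n → does (excedanceValue? f₁ i) ≡ does (excedanceValue? f₂ i)
  sameExcedanceValues i<n =
    trans (sym (closes-stepOf _ _)) (trans (cong closes (sameStep i<n)) (closes-stepOf _ _))
  module S₁₂ = SameSteps ad₁ ad₂ sameExcedances sameExcedanceValues
  module S₂₁ = SameSteps ad₂ ad₁ (sym ∘ sameExcedances) (sym ∘ sameExcedanceValues)
  agreeAt : ∀ p → (∀ {q} → q < p → q < n → f₁ q ≡ f₂ q) → p < n → f₁ p ≡ f₂ p
  agreeAt p agreeBelow p<n =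
    ≤-antisym (≮⇒≥ (S₂₁.f₁≮f₂ p<n (sym ∘ below))) (≮⇒≥ (S₁₂.f₁≮f₂ p<n below))
    where
    below : ∀ {q} → q < p → f₁ q ≡ f₂ q
    below q<p = agreeBelow q<p (<-trans q<p p<n)

-- Decoding a path

tabulate-isPath : ∀ n (σ : ℕ → Step) (h : ℕ → ℕ) →
                  (∀ {i} → i < n → LegalStep (h i) (σ i) (h (suc i))) → h n ≡ 0 →
                  IsTrue (isPathᵇ (h 0) (tabulateℕ n σ))
tabulate-isPath zero    σ h legal hₙ≡0 rewrite hₙ≡0 = _
tabulate-isPath (suc n) σ h legal hₙ≡0 =
  isPath-∷⁺ (legal (s≤s z≤n)) (tabulate-isPath n (σ ∘ suc) (h ∘ suc) (legal ∘ s≤s) hₙ≡0)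

record ArcBounds (h n : ℕ) (a b : ℕ → Bool) : Set where
  field
    closes≤opens : ∀ {i} → i < n → count b (suc i) ≤ h + count a i
    closes<opens : ∀ {i} → i < n → count b i < h + count a (suc i)
    allClosed    : h + count a n ≡ count b n

legalStep-balance : ∀ {h s h′} → LegalStep h s h′ →
                    h′ + boolToℕ (closes s) ≡ h + boolToℕ (opens s)
legalStep-balance {h} up   = trans (+-identityʳ (suc h)) (+-comm 1 h)
legalStep-balance {h′ = h} down = trans (+-comm h 1) (sym (+-identityʳ (suc h)))
legalStep-balance flat₁    = refl
legalStep-balance flat₂    = refl

legalStep-closes≤ : ∀ {h s h′} → LegalStep h s h′ → boolToℕ (closes s) ≤ h
legalStep-closes≤ up    = z≤n
legalStep-closes≤ down  = s≤s z≤n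
legalStep-closes≤ flat₁ = s≤s z≤n
legalStep-closes≤ flat₂ = z≤n

legalStep-positive : ∀ {h s h′} → LegalStep h s h′ → 1 ≤ h + boolToℕ (opens s)
legalStep-positive {h} up = subst (1 ≤_) (+-comm 1 h) (s≤s z≤n)
legalStep-positive down   = s≤s z≤n
legalStep-positive flat₁  = s≤s z≤n
legalStep-positive flat₂  = s≤s z≤n

isPath-arcBounds : ∀ {n} h (v : Vec Step n) → IsTrue (isPathᵇ h v) →
                   ArcBounds h n (opens ∘ lookupOr U v) (closes ∘ lookupOr U v)
isPath-arcBounds zero [] _ = record { closes≤opens = λ () ; closes<opens = λ () ; allClosed = refl }
isPath-arcBounds {suc n} h (s ∷ v) p with isPath-∷⁻ h s v p
... | h′ , legal , p′ = record
  { closes≤opens = λ { {zero} _ → +-monoˡ-≤ 0 (legalStep-closes≤ legal)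
                     ; {suc i} (s≤s i<n) → ≤-trans (+-monoʳ-≤ β (closes≤opens i<n)) (≤-reflexive (shift _)) }
  ; closes<opens = λ { {zero} _ → subst (1 ≤_) (cong (h +_) (sym (+-identityʳ α))) (legalStep-positive legal)
                     ; {suc i} (s≤s i<n) → <-≤-trans (+-monoʳ-< β (closes<opens i<n)) (≤-reflexive (shift _)) }
  ; allClosed    = trans (sym (shift _)) (cong (β +_) allClosed)
  }
  where
  open ArcBounds (isPath-arcBounds h′ v p′)
  α = boolToℕ (opens s)
  β = boolToℕ (closes s)
  regroup : ∀ a b c → a + (b + c) ≡ (b + a) + c
  regroup = solve-∀
  shift : ∀ z → β + (h′ + z) ≡ h + (α + z)
  shift z = begin
    β + (h′ + z)   ≡⟨ regroup β h′ z ⟩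
    h′ + β + z     ≡⟨ cong (_+ z) (legalStep-balance legal) ⟩
    h + α + z      ≡⟨ +-assoc h α z ⟩
    h + (α + z)    ∎
    where open ≡-Reasoning

module Decoding {n} {a b : ℕ → Bool} (bounds : ArcBounds 0 n a b) where

  open ArcBounds bounds

  -- The k-th opening position goes to the k-th closing position, the k-th other position to the
  -- k-th non-closing position.
  decodeAt : ℕ → ℕ
  decodeAt p = if a p then nth b (count a p) n else nth (not ∘ b) (count (not ∘ a) p) n

  decodeAt-opener : ∀ {p} → p < n → a p ≡ true →
                    decodeAt p < n × b (decodeAt p) ≡ true ×
                    count b (decodeAt p) ≡ count a p × p < decodeAt p
  decodeAt-opener {p} p<n ap rewrite ap
    with nth-spec b (count a p) n (subst (count a p <_) allClosed (count-strict a ap p<n))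
  ... | s<n , bs , cs = s<n , bs , cs , count-reflects-< a (begin-strict
    count a p          ≡⟨ cs ⟨
    count b s          <⟨ n<1+n _ ⟩
    suc (count b s)    ≡⟨ count-suc-true b bs ⟨
    count b (suc s)    ≤⟨ closes≤opens s<n ⟩
    count a s          ∎)
    where
    open ≤-Reasoning
    s = nth b (count a p) n

  nonClosersMatch : count (not ∘ a) n ≡ count (not ∘ b) n
  nonClosersMatch = +-cancelʳ-≡ _ _ _ (begin
    count (not ∘ a) n + count a n     ≡⟨ count-not a n ⟩
    n                                 ≡⟨ count-not b n ⟨
    count (not ∘ b) n + count b n     ≡⟨ cong (count (not ∘ b) n +_) allClosed ⟨
    count (not ∘ b) n + count a n     ∎)
    where open ≡-Reasoning

  decodeAt-nonOpener : ∀ {p} → p < n → a p ≡ false →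
                       decodeAt p < n × b (decodeAt p) ≡ false ×
                       count (not ∘ b) (decodeAt p) ≡ count (not ∘ a) p × decodeAt p < p
  decodeAt-nonOpener {p} p<n ap rewrite ap
    with nth-spec (not ∘ b) (count (not ∘ a) p) n
           (subst (count (not ∘ a) p <_) nonClosersMatch (count-strict (not ∘ a) (cong not ap) p<n))
  ... | s<n , nbs , cs = s<n , not-injective nbs , cs , count-reflects-< (not ∘ b)
        (subst (_< count (not ∘ b) p) (sym cs) (<-from-sums balance closes<opens′))
    where
    balance : count (not ∘ a) p + count a p ≡ count (not ∘ b) p + count b p
    balance = trans (count-not a p) (sym (count-not b p))
    closes<opens′ : count b p < count a p
    closes<opens′ = subst (count b p <_) (count-suc-false a ap) (closes<opens p<n)

  opener-exceeded : ∀ {p} → p < n → a p ≡ true → p < decodeAt p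
  opener-exceeded p<n ap = proj₂ (proj₂ (proj₂ (decodeAt-opener p<n ap)))

  nonOpener-deficient : ∀ {p} → p < n → a p ≡ false → decodeAt p < p
  nonOpener-deficient p<n ap = proj₂ (proj₂ (proj₂ (decodeAt-nonOpener p<n ap)))

  closes-decodeAt : ∀ {p} → p < n → b (decodeAt p) ≡ a p
  closes-decodeAt {p} p<n = boolCases (a p)
    (λ ap → trans (proj₁ (proj₂ (decodeAt-opener p<n ap))) (sym ap))
    (λ ap → trans (proj₁ (proj₂ (decodeAt-nonOpener p<n ap))) (sym ap))

  decodeAt-increasing : ∀ {p q} → p < q → q < n → a p ≡ a q → decodeAt p < decodeAt q
  decodeAt-increasing {p} {q} p<q q<n ap≡aq = boolCases (a p) opener nonOpener
    where
    p<n = <-trans p<q q<n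
    opener : a p ≡ true → decodeAt p < decodeAt q
    opener ap with decodeAt-opener p<n ap | decodeAt-opener q<n (trans (sym ap≡aq) ap)
    ... | _ , _ , cp , _ | _ , _ , cq , _ =
      count-reflects-< b (subst₂ _<_ (sym cp) (sym cq) (count-strict a ap p<q))
    nonOpener : a p ≡ false → decodeAt p < decodeAt q
    nonOpener ap with decodeAt-nonOpener p<n ap | decodeAt-nonOpener q<n (trans (sym ap≡aq) ap)
    ... | _ , _ , cp , _ | _ , _ , cq , _ =
      count-reflects-< (not ∘ b) (subst₂ _<_ (sym cp) (sym cq) (count-strict (not ∘ a) (cong not ap) p<q))

  decodeAt-isAvoidingDerangement : IsAvoidingDerangement n decodeAt
  decodeAt-isAvoidingDerangement = record
    { bounded        = bounded
    ; injective      = injective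
    ; fixedPointFree = fixedPointFree
    ; avoids321      = avoids321
    }
    where
    bounded : MapsBelow n n decodeAt
    bounded {p} p<n = boolCases (a p) (proj₁ ∘ decodeAt-opener p<n) (proj₁ ∘ decodeAt-nonOpener p<n)
    sameOpening : ∀ {x y} → x < n → y < n → decodeAt x ≡ decodeAt y → a x ≡ a y
    sameOpening x<n y<n dx≡dy =
      trans (sym (closes-decodeAt x<n)) (trans (cong b dx≡dy) (closes-decodeAt y<n))
    injective : InjectiveBelow n decodeAt
    injective {x} {y} x<n y<n dx≡dy with <-cmp x y
    ... | tri< x<y _ _ =
      ⊥-elim (<-irrefl dx≡dy (decodeAt-increasing x<y y<n (sameOpening x<n y<n dx≡dy)))
    ... | tri≈ _ x≡y _ = x≡y
    ... | tri> _ _ y<x =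
      ⊥-elim (<-irrefl (sym dx≡dy) (decodeAt-increasing y<x x<n (sameOpening y<n x<n (sym dx≡dy))))
    fixedPointFree : ∀ {p} → p < n → decodeAt p ≢ p
    fixedPointFree {p} p<n = boolCases (a p)
      (>⇒≢ ∘ opener-exceeded p<n) (<⇒≢ ∘ nonOpener-deficient p<n)
    avoids321 : ∀ {i j k} → i < j → j < k → k < n →
                decodeAt j < decodeAt i → decodeAt k < decodeAt j → ⊥
    avoids321 {i} {j} {k} i<j j<k k<n dj<di dk<dj with bool-pigeonhole (a i) (a j) (a k)
    ... | inj₁ ai≡aj        = <-asym dj<di (decodeAt-increasing i<j (<-trans j<k k<n) ai≡aj)
    ... | inj₂ (inj₁ aj≡ak) = <-asym dk<dj (decodeAt-increasing j<k k<n aj≡ak)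
    ... | inj₂ (inj₂ ai≡ak) =
      <-asym (<-trans dk<dj dj<di) (decodeAt-increasing (<-trans i<j j<k) k<n ai≡ak)

  excedance-decodeAt : ∀ {p} → p < n → does (excedance? decodeAt p) ≡ a p
  excedance-decodeAt {p} p<n = boolCases (a p)
    (λ ap → trans (dec-true (excedance? decodeAt p) (opener-exceeded p<n ap)) (sym ap))
    (λ ap → trans (dec-false (excedance? decodeAt p) (<⇒≯ (nonOpener-deficient p<n ap))) (sym ap))

  excedanceValue-decodeAt : ∀ {v} → v < n → does (excedanceValue? decodeAt v) ≡ b v
  excedanceValue-decodeAt {v} v<n = boolCases (b v) closer nonCloser
    where
    closer : b v ≡ true → does (excedanceValue? decodeAt v) ≡ b v
    closer bv with nth-spec a (count b v) n (subst (count b v <_) (sym allClosed) (count-strict b bv v<n))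
    ... | p<n , ap , cp with decodeAt-opener p<n ap
    ...   | _ , bdp , cdp , p<dp =
      trans (dec-true (excedanceValue? decodeAt v) (p , subst (p <_) dp≡v p<dp , dp≡v)) (sym bv)
      where
      p = nth a (count b v) n
      dp≡v : decodeAt p ≡ v
      dp≡v = count-injective b bdp bv (trans cdp cp)
    nonCloser : b v ≡ false → does (excedanceValue? decodeAt v) ≡ b v
    nonCloser bv = trans (dec-false (excedanceValue? decodeAt v) noPreimage) (sym bv)
      where
      noPreimage : ¬ (∃[ j ] j < v × decodeAt j ≡ v)
      noPreimage (j , j<v , dj≡v) = <-asym (subst (_< j) dj≡v dj<j) j<v
        where
        j<n = <-trans j<v v<n
        aj : a j ≡ false
        aj = trans (sym (closes-decodeAt j<n)) (trans (cong b dj≡v) bv)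
        dj<j = nonOpener-deficient j<n aj

module PathDecoding {n} (v : Vec Step n) (isPath : IsTrue (isPathᵇ 0 v)) where

  open Decoding (isPath-arcBounds 0 v isPath) public

  stepAt-decodeAt : ∀ {i} → i < n → stepAt decodeAt i ≡ lookupOr U v i
  stepAt-decodeAt i<n = trans (cong₂ stepOf (excedance-decodeAt i<n) (excedanceValue-decodeAt i<n))
                              (stepOf-opens-closes (lookupOr U v _))

allF⁻ : ∀ {n} (p : Fin n → Bool) → IsTrue (allF p) → ∀ i → IsTrue (p i)
allF⁻ {n} p h i = All.lookup (Allₚ.all⁺ p (allFin n) h) (∈-allFin i)

allF⁺ : ∀ {n} (p : Fin n → Bool) → (∀ i → IsTrue (p i)) → IsTrue (allF p)
allF⁺ p h = Allₚ.all⁻ p (Allₚ.tabulate⁺ h)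

anyF⁻ : ∀ {n} (p : Fin n → Bool) → IsTrue (anyF p) → ∃ λ i → IsTrue (p i)
anyF⁻ {n} p h = satisfied (Anyₚ.any⁻ p (allFin n) h)

anyF⁺ : ∀ {n} (p : Fin n → Bool) i → IsTrue (p i) → IsTrue (anyF p)
anyF⁺ p i h = Anyₚ.any⁺ p (Anyₚ.tabulate⁺ i h)

T-not⇔¬ : ∀ {x} → IsTrue (not x) ⇔ (¬ IsTrue x)
T-not⇔¬ {true}  = mk⇔ (λ ()) (λ ¬t → ¬t _)
T-not⇔¬ {false} = mk⇔ (λ _ ()) (λ _ → _)

T-not-∨⇔→ : ∀ {x y} → IsTrue (not x ∨ y) ⇔ (IsTrue x → IsTrue y)
T-not-∨⇔→ {true}  = mk⇔ (λ ty _ → ty) (λ f → f _)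
T-not-∨⇔→ {false} = mk⇔ (λ _ ()) (λ _ → _)

module _ {n} (w : Vec (Fin n) n) where

  private
    v : Fin n → ℕ
    v i = toℕ (lookup w i)

  T-isPerm⇔ : IsTrue (isPermᵇ w) ⇔ (∀ i j → v i ≡ v j → toℕ i ≡ toℕ j)
  T-isPerm⇔ = mk⇔
    (λ h i j vi≡vj →
      ≡ᵇ⇒≡ _ _ (Equivalence.to T-not-∨⇔→ (allF⁻ _ (allF⁻ _ h i) j) (≡⇒≡ᵇ _ _ vi≡vj)))
    (λ h → allF⁺ _ λ i → allF⁺ _ λ j →
      Equivalence.from T-not-∨⇔→ λ t → ≡⇒≡ᵇ _ _ (h i j (≡ᵇ⇒≡ _ _ t)))

  T-isDerangement⇔ : IsTrue (isDerangementᵇ w) ⇔ (∀ i → v i ≢ toℕ i)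
  T-isDerangement⇔ = mk⇔
    (λ h i vi≡i → Equivalence.to T-not⇔¬ (allF⁻ _ h i) (≡⇒≡ᵇ _ _ vi≡i))
    (λ h → allF⁺ _ λ i → Equivalence.from T-not⇔¬ λ t → h i (≡ᵇ⇒≡ _ _ t))

  Pattern321 : Fin n → Fin n → Fin n → Set
  Pattern321 i j k = toℕ i < toℕ j × toℕ j < toℕ k × v j < v i × v k < v j

  T-contains321⇔ : IsTrue (contains321ᵇ w) ⇔ (∃[ i ] ∃[ j ] ∃[ k ] Pattern321 i j k)
  T-contains321⇔ = mk⇔ to from
    where
    to : IsTrue (contains321ᵇ w) → ∃[ i ] ∃[ j ] ∃[ k ] Pattern321 i j k
    to t with anyF⁻ _ t
    ... | i , tᵢ with anyF⁻ _ tᵢ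
    ... | j , tⱼ with anyF⁻ _ tⱼ
    ... | k , tₖ with Equivalence.to T-∧ tₖ
    ... | i<j , t₁ with Equivalence.to T-∧ t₁
    ... | j<k , t₂ with Equivalence.to T-∧ t₂
    ... | vj<vi , vk<vj =
      i , j , k , <ᵇ⇒< _ _ i<j , <ᵇ⇒< _ _ j<k , <ᵇ⇒< _ _ vj<vi , <ᵇ⇒< _ _ vk<vj
    from : ∃[ i ] ∃[ j ] ∃[ k ] Pattern321 i j k → IsTrue (contains321ᵇ w)
    from (i , j , k , i<j , j<k , vj<vi , vk<vj) = anyF⁺ _ i (anyF⁺ _ j (anyF⁺ _ k
      (Equivalence.from T-∧ (<⇒<ᵇ i<j , Equivalence.from T-∧ (<⇒<ᵇ j<k ,
        Equivalence.from T-∧ (<⇒<ᵇ vj<vi , <⇒<ᵇ vk<vj))))))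

  T-avoids321⇔ : IsTrue (avoids321ᵇ w) ⇔ (∀ i j k → ¬ Pattern321 i j k)
  T-avoids321⇔ = mk⇔
    (λ h i j k pat → Equivalence.to T-not⇔¬ h (Equivalence.from T-contains321⇔ (i , j , k , pat)))
    (λ h → Equivalence.from T-not⇔¬ λ t →
      let (i , j , k , pat) = Equivalence.to T-contains321⇔ t in h i j k pat)

IsAvoidingWord : ∀ {n} → Vec (Fin n) n → Set
IsAvoidingWord w = IsTrue (isPermᵇ w ∧ isDerangementᵇ w ∧ avoids321ᵇ w)

word⇔isAvoidingDerangement : ∀ {n} (w : Vec (Fin n) n) {f : ℕ → ℕ} →
                             (∀ i → toℕ (lookup w i) ≡ f (toℕ i)) →
                             IsAvoidingWord w ⇔ IsAvoidingDerangement n f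
word⇔isAvoidingDerangement {n} w {f} w≗f = mk⇔ to from
  where
  to : IsAvoidingWord w → IsAvoidingDerangement n f
  to h = record
    { bounded = bounded ; injective = injective ; fixedPointFree = fixedPointFree ; avoids321 = avoids321 }
    where
    perm  = Equivalence.to (T-∧ {isPermᵇ w}) h .proj₁
    rest  = Equivalence.to (T-∧ {isPermᵇ w}) h .proj₂
    der   = Equivalence.to (T-∧ {isDerangementᵇ w}) rest .proj₁
    avoid = Equivalence.to (T-∧ {isDerangementᵇ w}) rest .proj₂
    bounded : MapsBelow n n f
    bounded x<n with fromFin x<n
    ... | i , refl = subst (_< n) (w≗f i) (toℕ<n (lookup w i))
    injective : InjectiveBelow n f
    injective x<n y<n fx≡fy with fromFin x<n | fromFin y<n
    ... | i , refl | j , refl =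
      Equivalence.to (T-isPerm⇔ w) perm i j (trans (w≗f i) (trans fx≡fy (sym (w≗f j))))
    fixedPointFree : ∀ {x} → x < n → f x ≢ x
    fixedPointFree x<n fx≡x with fromFin x<n
    ... | i , refl = Equivalence.to (T-isDerangement⇔ w) der i (trans (w≗f i) fx≡x)
    avoids321 : ∀ {x y z} → x < y → y < z → z < n → f y < f x → f z < f y → ⊥
    avoids321 x<y y<z z<n fy<fx fz<fy
      with fromFin (<-trans x<y (<-trans y<z z<n)) | fromFin (<-trans y<z z<n) | fromFin z<n
    ... | i , refl | j , refl | k , refl = Equivalence.to (T-avoids321⇔ w) avoid i j k
      (x<y , y<z , subst₂ _<_ (sym (w≗f j)) (sym (w≗f i)) fy<fx ,
                   subst₂ _<_ (sym (w≗f k)) (sym (w≗f j)) fz<fy)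
  from : IsAvoidingDerangement n f → IsAvoidingWord w
  from ad = Equivalence.from (T-∧ {isPermᵇ w}) (Equivalence.from (T-isPerm⇔ w) perm ,
            Equivalence.from (T-∧ {isDerangementᵇ w})
              (Equivalence.from (T-isDerangement⇔ w) der , Equivalence.from (T-avoids321⇔ w) avoid))
    where
    open IsAvoidingDerangement ad
    perm : ∀ i j → toℕ (lookup w i) ≡ toℕ (lookup w j) → toℕ i ≡ toℕ j
    perm i j vi≡vj = injective (toℕ<n i) (toℕ<n j) (trans (sym (w≗f i)) (trans vi≡vj (w≗f j)))
    der : ∀ i → toℕ (lookup w i) ≢ toℕ i
    der i vi≡i = fixedPointFree (toℕ<n i) (trans (sym (w≗f i)) vi≡i)
    avoid : ∀ i j k → ¬ Pattern321 w i j k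
    avoid i j k (i<j , j<k , vj<vi , vk<vj) =
      avoids321 i<j j<k (toℕ<n k) (subst₂ _<_ (w≗f j) (w≗f i) vj<vi) (subst₂ _<_ (w≗f k) (w≗f j) vk<vj)

valueAt : ∀ {n} → Vec (Fin n) n → ℕ → ℕ
valueAt w = lookupOr 0 (Vec.map toℕ w)

valueAt-lookup : ∀ {n} (w : Vec (Fin n) n) i → toℕ (lookup w i) ≡ valueAt w (toℕ i)
valueAt-lookup w i = sym (trans (lookupOr-toℕ 0 (Vec.map toℕ w) i) (lookup-map i toℕ w))

word-ext : ∀ {n} {w w′ : Vec (Fin n) n} → (∀ i → toℕ (lookup w i) ≡ toℕ (lookup w′ i)) → w ≡ w′
word-ext {w = w} {w′} w≗w′ = begin
  w                      ≡⟨ tabulate∘lookup w ⟨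
  tabulate (lookup w)    ≡⟨ tabulate-cong (toℕ-injective ∘ w≗w′) ⟩
  tabulate (lookup w′)   ≡⟨ tabulate∘lookup w′ ⟩
  w′                     ∎
  where open ≡-Reasoning

module _ {n f} (ad : IsAvoidingDerangement n f) where

  open IsAvoidingDerangement ad using (bounded)

  wordOf : Vec (Fin n) n
  wordOf = tabulate (restrict bounded)

  wordOf-lookup : ∀ i → toℕ (lookup wordOf i) ≡ f (toℕ i)
  wordOf-lookup i = trans (cong toℕ (lookup∘tabulate (restrict bounded) i)) (toℕ-restrict bounded i)

  valueAt-wordOf : ∀ {x} → x < n → valueAt wordOf x ≡ f x
  valueAt-wordOf x<n with fromFin x<n
  ... | i , refl = trans (sym (valueAt-lookup wordOf i)) (wordOf-lookup i)

word-isAvoidingDerangement : ∀ {n} (w : Vec (Fin n) n) → IsAvoidingWord w →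
                             IsAvoidingDerangement n (valueAt w)
word-isAvoidingDerangement w = Equivalence.to (word⇔isAvoidingDerangement w (valueAt-lookup w))

-- The bijection

module _ {n : ℕ} where

  toPath : AvoidingDerangement n → Path n 0
  toPath (w , p) =
    tabulateℕ n (stepAt f) , tabulate-isPath n (stepAt f) (height f) height-step height-end
    where
    f = valueAt w
    open AvoidingDerangementProperties (word-isAvoidingDerangement w p)

  fromPath : Path n 0 → AvoidingDerangement n
  fromPath (v , p) =
    wordOf ad , Equivalence.from (word⇔isAvoidingDerangement (wordOf ad) (wordOf-lookup ad)) ad
    where
    ad = PathDecoding.decodeAt-isAvoidingDerangement v p

  toPath∘fromPath : ∀ x → toPath (fromPath x) ≡ x
  toPath∘fromPath (v , p) = ≡-withProof (begin
    tabulateℕ n (stepAt (valueAt (wordOf ad)))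
      ≡⟨ tabulateℕ-cong n (λ i<n → trans (stepAt-cong (valueAt-wordOf ad) i<n) (stepAt-decodeAt i<n)) ⟩
    tabulateℕ n (lookupOr U v)
      ≡⟨ tabulateℕ-lookupOr U v ⟩
    v
      ∎)
    where
    open ≡-Reasoning
    open PathDecoding v p
    ad = decodeAt-isAvoidingDerangement

  fromPath∘toPath : ∀ x → fromPath (toPath x) ≡ x
  fromPath∘toPath x@(w , p) = ≡-withProof (word-ext λ i → begin
    toℕ (lookup (wordOf ad) i)    ≡⟨ wordOf-lookup ad i ⟩
    decodeAt (toℕ i)              ≡⟨ steps-determine ad adw sameSteps (toℕ<n i) ⟩
    valueAt w (toℕ i)             ≡⟨ valueAt-lookup w i ⟨
    toℕ (lookup w i)              ∎)
    where
    open ≡-Reasoning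
    v = proj₁ (toPath x)
    open PathDecoding v (proj₂ (toPath x))
    ad = decodeAt-isAvoidingDerangement
    adw = word-isAvoidingDerangement w p
    sameSteps : ∀ {i} → i < n → stepAt decodeAt i ≡ stepAt (valueAt w) i
    sameSteps i<n = trans (stepAt-decodeAt i<n) (lookupOr-tabulateℕ U (stepAt (valueAt w)) i<n)

AvoidingDerangement↔Path : ∀ n → AvoidingDerangement n ↔ Path n 0
AvoidingDerangement↔Path n = mk↔ₛ′ toPath fromPath toPath∘fromPath fromPath∘toPath

theorem2 : (m : ℕ) → AvoidingDerangement (2 + m) ↔ Fin (nodesAtDepth m)
theorem2 m = ↔-trans (AvoidingDerangement↔Path (2 + m))
  (subst (λ k → Path (2 + m) 0 ↔ Fin k) (sym (nodesAtDepth≡pathCount m)) (Path↔Fin (2 + m) 0))
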